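{- Let $q=p^n$ with $p$ prime. Let $V[x]$ be the $\mathbb{F}_q$-vector space of polynomials $f\in\mathbb{F}_q[x]$ of degree at most $q-2$ with $f(0)=0$, and for $r\in\mathbb{F}_q$ let $A_r:V[x]\to V[x]$ be the linear map $A_r(f)(x)=f(x+r)-f(r)$. Then for all $r\in\mathbb{F}_q$, $i\in\mathbb{F}_p^*$ and $k=1,2,\ldots,p$, $$\ker(A_r-I)^k=\ker(A_{ir}-I)^k.$$
   Context: Polynomials in $V[x]$ are formal polynomials; $f(x+r)$ denotes formal substitution; $I$ is the identity map of $V[x]$. -}

module Defs where

open import Level using (Level)
open import Data.Nat using (ℕ; zero; suc)
open import Data.Fin using (Fin)
open import Data.Vec using (Vec; []; _∷_; zipWith; map; replicate; _∷ʳ_; lookup)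
open import Data.Product using (∃)
open import Relation.Nullary using (¬_)
open import Algebra.Bundles using (CommutativeRing)

IsField : ∀ {c ℓ} → CommutativeRing c ℓ → Set (c Level.⊔ ℓ)
IsField R = ¬ (0# ≈ 1#) × (∀ x → ¬ (x ≈ 0#) → ∃ λ y → x * y ≈ 1#)
  where open CommutativeRing R
        open import Data.Product using (_×_)

module Poly {c ℓ} (R : CommutativeRing c ℓ) where
  open CommutativeRing R

  -- Polynomials with coefficients in R of degree < m are coefficient vectors
  -- Vec Carrier m; entry j is the coefficient of x^j.

  0p : ∀ {m} → Vec Carrier m
  0p = replicate _ 0#

  const : ∀ {m} → Carrier → Vec Carrier (suc m)
  const a = a ∷ 0p

  _+p_ : ∀ {m} → Vec Carrier m → Vec Carrier m → Vec Carrier m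
  _+p_ = zipWith _+_

  _-p_ : ∀ {m} → Vec Carrier m → Vec Carrier m → Vec Carrier m
  _-p_ = zipWith _-_

  -- (x + r) · h, exact product (degree goes up by one)
  mulXr : ∀ {m} → Carrier → Vec Carrier m → Vec Carrier (suc m)
  mulXr r h = (0# ∷ h) +p (map (r *_) h ∷ʳ 0#)

  eval : ∀ {m} → Carrier → Vec Carrier m → Carrier
  eval r [] = 0#
  eval r (a ∷ g) = a + r * eval r g

  -- formal substitution f(x + r):  f = c + x·g  ⇒  f(x+r) = c + (x+r)·g(x+r)
  subst : ∀ {m} → Carrier → Vec Carrier m → Vec Carrier m
  subst r [] = []
  subst r (a ∷ g) = const a +p mulXr r (subst r g)

  A : ∀ {m} → Carrier → Vec Carrier (suc m) → Vec Carrier (suc m)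
  A r f = subst r f -p const (eval r f)

  A-I : ∀ {m} → Carrier → Vec Carrier (suc m) → Vec Carrier (suc m)
  A-I r f = A r f -p f

  iter : ∀ {a} {X : Set a} → ℕ → (X → X) → X → X
  iter zero    g x = x
  iter (suc k) g x = g (iter k g x)

  IsZeroPoly : ∀ {m} → Vec Carrier m → Set ℓ
  IsZeroPoly f = ∀ j → lookup f j ≈ 0#

  natCast : ℕ → Carrier
  natCast zero = 0#
  natCast (suc n) = 1# + natCast n

{-# OPTIONS --safe #-}
-- Write T = A_r and Δ = T - I. Since T is additive and commutes with Δ, the kernel of Δᵏ
-- is a subgroup stable under T, and Δ maps the kernel of Δᵏ⁺¹ into that of Δᵏ. From
-- Tʲ⁺¹ - I = T ∘ (Tʲ - I) + Δ one gets by induction on j that Tʲ - I also maps the kernel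
-- of Δᵏ⁺¹ into that of Δᵏ, and then by induction on k that ker Δᵏ ⊆ ker (Tʲ - I)ᵏ.
-- Translations compose, A_r ∘ A_s = A_{r+s}, so A_{(j+1) r} = Tʲ⁺¹; this gives
-- ker (A_r - I)ᵏ ⊆ ker (A_{mr} - I)ᵏ, and the reverse inclusion follows by applying it
-- to m r and an inverse of m modulo p.
module Submission where

open import Defs
open import Data.Nat using (ℕ; zero; suc; _∸_; _^_; _≤_; _<_; NonZero)
open import Data.Nat.Primality using (Prime)
open import Data.Fin using (Fin; zero; suc)
open import Data.Vec using (Vec; []; _∷_; map; head; _∷ʳ_)
open import Data.Product using (_,_; ∃)
open import Relation.Binary.PropositionalEquality using (_≡_)
open import Relation.Binary.PropositionalEquality.Properties using (setoid)
open import Function.Bundles using (Bijection; _⇔_; mk⇔)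
open import Algebra.Bundles using (CommutativeRing; Group; AbelianGroup)

open import Level using (_⊔_)
open import Data.Vec.Properties using (map-∷ʳ; lookup-replicate)
open import Data.Nat.Coprimality using (coprime-Bézout; prime⇒coprime)
open import Data.Nat.GCD using (module Bézout)
open import Function using (_∘_)
import Data.Nat as ℕ
import Data.Nat.Properties as ℕ
open import Data.Nat.GeneralisedArithmetic using (fold; fold-+)
import Relation.Binary.PropositionalEquality as ≡
import Relation.Binary.Reasoning.Setoid as SetoidReasoning

fold-shift : ∀ {a} {A : Set a} (z : A) (s : A → A) m → fold (s z) s m ≡ fold z s (suc m)
fold-shift z s m = ≡.trans (≡.sym (fold-+ z s m)) (≡.cong (fold z s) (ℕ.+-comm m 1))

module GroupHomomorphism
  {g₁ g₂ h₁ h₂} (G : Group g₁ g₂) (H : Group h₁ h₂)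
  (f : Group.Carrier G → Group.Carrier H)
  (f-cong : ∀ {x y} → Group._≈_ G x y → Group._≈_ H (f x) (f y))
  (f-homo : ∀ x y → Group._≈_ H (f (Group._∙_ G x y)) (Group._∙_ H (f x) (f y)))
  where

  private
    module G = Group G
  open Group H
  open import Algebra.Properties.Group H using (identityˡ-unique; inverseˡ-unique)

  homo-ε : f G.ε ≈ ε
  homo-ε = identityˡ-unique (f G.ε) (f G.ε) (trans (sym (f-homo G.ε G.ε)) (f-cong (G.identityˡ G.ε)))

  homo-⁻¹ : ∀ x → f (x G.⁻¹) ≈ f x ⁻¹
  homo-⁻¹ x = inverseˡ-unique (f (x G.⁻¹)) (f x)
    (trans (sym (f-homo (x G.⁻¹) x)) (trans (f-cong (G.inverseˡ x)) homo-ε))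

  homo-// : ∀ x y → f (x G.// y) ≈ f x // f y
  homo-// x y = trans (f-homo x (y G.⁻¹)) (∙-congˡ (homo-⁻¹ y))

module _ {a ℓ} (G : AbelianGroup a ℓ) where
  open AbelianGroup G
  open import Algebra.Properties.AbelianGroup G using (⁻¹-∙-comm)
  open import Algebra.Properties.CommutativeSemigroup commutativeSemigroup using (interchange)
  open SetoidReasoning (AbelianGroup.setoid G)

  -‿interchange : ∀ a b c d → (a ∙ b) - (c ∙ d) ≈ (a - c) ∙ (b - d)
  -‿interchange a b c d = begin
    (a ∙ b) ∙ (c ∙ d) ⁻¹     ≈⟨ ∙-congˡ (⁻¹-∙-comm c d) ⟨
    (a ∙ b) ∙ (c ⁻¹ ∙ d ⁻¹)  ≈⟨ interchange a b (c ⁻¹) (d ⁻¹) ⟩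
    (a - c) ∙ (b - d)        ∎

module _ {a ℓ} (G : Group a ℓ) where
  open Group G
  open import Algebra.Properties.Group G using (//-rightDividesˡ)
  //-chain : ∀ a b c → (a // b) ∙ (b // c) ≈ a // c
  //-chain a b c = trans (sym (assoc (a // b) b (c ⁻¹))) (∙-congʳ (//-rightDividesˡ b a))

module DifferenceOperator
  {a ℓ} (G : AbelianGroup a ℓ)
  (T : AbelianGroup.Carrier G → AbelianGroup.Carrier G)
  (T-cong : ∀ {x y} → AbelianGroup._≈_ G x y → AbelianGroup._≈_ G (T x) (T y))
  (T-homo : ∀ x y → AbelianGroup._≈_ G (T (AbelianGroup._∙_ G x y)) (AbelianGroup._∙_ G (T x) (T y)))
  where

  open AbelianGroup G

  open GroupHomomorphism group group T T-cong T-homo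
    renaming (homo-ε to T-ε; homo-// to T-//)
  open SetoidReasoning (AbelianGroup.setoid G)

  Δ : Carrier → Carrier
  Δ x = T x - x

  Δ-cong : ∀ {x y} → x ≈ y → Δ x ≈ Δ y
  Δ-cong x≈y = ∙-cong (T-cong x≈y) (⁻¹-cong x≈y)

  Δ-homo : ∀ x y → Δ (x ∙ y) ≈ Δ x ∙ Δ y
  Δ-homo x y = trans (∙-congʳ (T-homo x y)) (-‿interchange G (T x) (T y) x y)

  Δⁿ-cong : ∀ k {x y} → x ≈ y → fold x Δ k ≈ fold y Δ k
  Δⁿ-cong zero    x≈y = x≈y
  Δⁿ-cong (suc k) x≈y = Δ-cong (Δⁿ-cong k x≈y)

  Δⁿ-homo : ∀ k x y → fold (x ∙ y) Δ k ≈ fold x Δ k ∙ fold y Δ k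
  Δⁿ-homo zero    x y = refl
  Δⁿ-homo (suc k) x y = trans (Δ-cong (Δⁿ-homo k x y)) (Δ-homo _ _)

  Δⁿ-T : ∀ k x → fold (T x) Δ k ≈ T (fold x Δ k)
  Δⁿ-T zero    x = refl
  Δⁿ-T (suc k) x = trans (Δ-cong (Δⁿ-T k x)) (sym (T-// _ _))

  Ker : ℕ → Carrier → Set ℓ
  Ker k x = fold x Δ k ≈ ε

  Ker-resp : ∀ k {x y} → x ≈ y → Ker k x → Ker k y
  Ker-resp k x≈y kx = trans (Δⁿ-cong k (sym x≈y)) kx

  Ker-ε : ∀ k → Ker k ε
  Ker-ε k = GroupHomomorphism.homo-ε group group (λ x → fold x Δ k) (Δⁿ-cong k) (Δⁿ-homo k)

  Ker-∙ : ∀ k {x y} → Ker k x → Ker k y → Ker k (x ∙ y)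
  Ker-∙ k {x} {y} kx ky = trans (Δⁿ-homo k x y) (trans (∙-cong kx ky) (identityˡ ε))

  Ker-T : ∀ k {x} → Ker k x → Ker k (T x)
  Ker-T k {x} kx = trans (Δⁿ-T k x) (trans (T-cong kx) T-ε)

  Ker-Δ : ∀ k {x} → Ker (suc k) x → Ker k (Δ x)
  Ker-Δ k {x} kx = ≡.subst (_≈ ε) (≡.sym (fold-shift x Δ k)) kx

  Δ[_] : ℕ → Carrier → Carrier
  Δ[ j ] x = fold x T j - x

  Δ[suc] : ∀ j x → Δ[ suc j ] x ≈ T (Δ[ j ] x) ∙ Δ x
  Δ[suc] j x = begin
    T (fold x T j) - x                    ≈⟨ //-chain group _ (T x) x ⟨
    (T (fold x T j) - T x) ∙ (T x - x)    ≈⟨ ∙-congʳ (T-// (fold x T j) x) ⟨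
    T (Δ[ j ] x) ∙ Δ x                    ∎

  Ker-Δ[_] : ∀ j k {x} → Ker (suc k) x → Ker k (Δ[ j ] x)
  Ker-Δ[ zero  ] k {x} kx = Ker-resp k (sym (inverseʳ x)) (Ker-ε k)
  Ker-Δ[ suc j ] k {x} kx =
    Ker-resp k (sym (Δ[suc] j x)) (Ker-∙ k (Ker-T k (Ker-Δ[ j ] k kx)) (Ker-Δ k kx))

  Ker⊆Ker-Δ[_] : ∀ j k {x} → Ker k x → fold x Δ[ j ] k ≈ ε
  Ker⊆Ker-Δ[ j ] zero    kx = kx
  Ker⊆Ker-Δ[ j ] (suc k) {x} kx =
    ≡.subst (_≈ ε) (fold-shift x Δ[ j ] k) (Ker⊆Ker-Δ[ j ] k (Ker-Δ[ j ] k kx))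

module Translation {c ℓ} (R : CommutativeRing c ℓ) where
  open CommutativeRing R hiding (zero)
  open Poly R
  open import Algebra.Properties.CommutativeSemigroup *-commutativeSemigroup using (x∙yz≈y∙xz)
  open import Data.Vec.Relation.Binary.Equality.Setoid (CommutativeRing.setoid R)
  import Data.Vec.Relation.Binary.Pointwise.Inductive as Pointwise

  ∷ʳ⁺ : ∀ {n x y} {u v : Vec Carrier n} → u ≋ v → x ≈ y → u ∷ʳ x ≋ v ∷ʳ y
  ∷ʳ⁺ []       x≈y = x≈y ∷ []
  ∷ʳ⁺ (p ∷ ps) x≈y = p ∷ ∷ʳ⁺ ps x≈y

  head⁺ : ∀ {n} {u v : Vec Carrier (suc n)} → u ≋ v → head u ≈ head v
  head⁺ (p ∷ _) = p

  +p-inverseˡ : ∀ {n} (u : Vec Carrier n) → map (-_) u +p u ≋ 0p {n}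
  +p-inverseˡ []      = []
  +p-inverseˡ (x ∷ u) = -‿inverseˡ x ∷ +p-inverseˡ u

  +p-inverseʳ : ∀ {n} (u : Vec Carrier n) → u +p map (-_) u ≋ 0p {n}
  +p-inverseʳ []      = []
  +p-inverseʳ (x ∷ u) = -‿inverseʳ x ∷ +p-inverseʳ u

  +p-abelianGroup : ℕ → AbelianGroup c (c ⊔ ℓ)
  +p-abelianGroup n = record
    { Carrier = Vec Carrier n
    ; _≈_ = _≋_
    ; _∙_ = _+p_
    ; ε = 0p
    ; _⁻¹ = map (-_)
    ; isAbelianGroup = record
      { isGroup = record
        { isMonoid = record
          { isSemigroup = record
            { isMagma = record
              { isEquivalence = ≋-isEquivalence n
              ; ∙-cong = Pointwise.zipWith-cong +-cong
              }
            ; assoc = Pointwise.zipWith-assoc +-assoc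
            }
          ; identity = Pointwise.zipWith-identityˡ +-identityˡ , Pointwise.zipWith-identityʳ +-identityʳ
          }
        ; inverse = +p-inverseˡ , +p-inverseʳ
        ; ⁻¹-cong = Pointwise.map⁺ -‿cong
        }
      ; comm = Pointwise.zipWith-comm +-comm
      }
    }

  module V {n : ℕ} where
    open AbelianGroup (+p-abelianGroup n) public
    open import Algebra.Properties.CommutativeSemigroup commutativeSemigroup public using (interchange)
    open import Algebra.Properties.AbelianGroup (+p-abelianGroup n) public using (ε⁻¹≈ε)

  module ≋-Reasoning {n : ℕ} = SetoidReasoning (≋-setoid n)

  -p≋- : ∀ {n} (u v : Vec Carrier n) → u -p v ≋ u V.- v
  -p≋- []      []      = []
  -p≋- (x ∷ u) (y ∷ v) = refl ∷ -p≋- u v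

  -p-cong : ∀ {n} {u u′ v v′ : Vec Carrier n} → u ≋ u′ → v ≋ v′ → u -p v ≋ u′ -p v′
  -p-cong = Pointwise.zipWith-cong (λ p q → +-cong p (-‿cong q))

  +p-∷ʳ0# : ∀ {n} (u v : Vec Carrier n) → (u ∷ʳ 0#) +p (v ∷ʳ 0#) ≋ (u +p v) ∷ʳ 0#
  +p-∷ʳ0# []      []      = +-identityˡ 0# ∷ []
  +p-∷ʳ0# (a ∷ u) (b ∷ v) = refl ∷ +p-∷ʳ0# u v

  0p∷ʳ0# : ∀ n → 0p {n} ∷ʳ 0# ≋ 0p {suc n}
  0p∷ʳ0# zero    = ≋-refl
  0p∷ʳ0# (suc n) = refl ∷ 0p∷ʳ0# n

  scale-+p : ∀ {n} s (u v : Vec Carrier n) → map (s *_) (u +p v) ≋ map (s *_) u +p map (s *_) v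
  scale-+p s []      []      = []
  scale-+p s (x ∷ u) (y ∷ v) = distribˡ s x y ∷ scale-+p s u v

  scale-0p : ∀ n s → map (s *_) (0p {n}) ≋ 0p {n}
  scale-0p zero    s = []
  scale-0p (suc n) s = zeroʳ s ∷ scale-0p n s

  scale-comm : ∀ {n} r s (u : Vec Carrier n) → map (r *_) (map (s *_) u) ≋ map (s *_) (map (r *_) u)
  scale-comm r s []      = []
  scale-comm r s (x ∷ u) = x∙yz≈y∙xz r s x ∷ scale-comm r s u

  scale-+ : ∀ {n} r s (u : Vec Carrier n) → map (r *_) u +p map (s *_) u ≋ map ((r + s) *_) u
  scale-+ r s []      = []
  scale-+ r s (x ∷ u) = sym (distribʳ x r s) ∷ scale-+ r s u

  const-cong : ∀ {n a b} → a ≈ b → const {n} a ≋ const {n} b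
  const-cong a≈b = a≈b ∷ ≋-refl

  const-+ : ∀ {n} a b → const {n} (a + b) ≋ const a +p const b
  const-+ a b = refl ∷ V.sym (V.identityˡ 0p)

  mulXr-cong : ∀ {n r s} {u v : Vec Carrier n} → r ≈ s → u ≋ v → mulXr r u ≋ mulXr s v
  mulXr-cong r≈s u≋v = V.∙-cong (refl ∷ u≋v) (∷ʳ⁺ (Pointwise.map⁺ (*-cong r≈s) u≋v) refl)

  mulXr-+p : ∀ {n} r (u v : Vec Carrier n) → mulXr r (u +p v) ≋ mulXr r u +p mulXr r v
  mulXr-+p r u v = begin
    (0# ∷ (u +p v)) +p (map (r *_) (u +p v) ∷ʳ 0#)
      ≈⟨ V.∙-cong (sym (+-identityˡ 0#) ∷ ≋-refl) (∷ʳ⁺ (scale-+p r u v) refl) ⟩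
    ((0# ∷ u) +p (0# ∷ v)) +p ((map (r *_) u +p map (r *_) v) ∷ʳ 0#)
      ≈⟨ V.∙-congˡ (+p-∷ʳ0# (map (r *_) u) (map (r *_) v)) ⟨
    ((0# ∷ u) +p (0# ∷ v)) +p ((map (r *_) u ∷ʳ 0#) +p (map (r *_) v ∷ʳ 0#))
      ≈⟨ V.interchange _ _ _ _ ⟩
    mulXr r u +p mulXr r v ∎
    where open ≋-Reasoning

  mulXr-0p : ∀ n r → mulXr r (0p {n}) ≋ 0p {suc n}
  mulXr-0p n r = GroupHomomorphism.homo-ε V.group V.group (mulXr r) (mulXr-cong refl) (mulXr-+p r)

  mulXr-∷ʳ : ∀ {n} r (w : Vec Carrier n) → mulXr r (w ∷ʳ 0#) ≋ mulXr r w ∷ʳ 0#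
  mulXr-∷ʳ r w = begin
    ((0# ∷ w) ∷ʳ 0#) +p (map (r *_) (w ∷ʳ 0#) ∷ʳ 0#)
      ≡⟨ ≡.cong (λ v → ((0# ∷ w) ∷ʳ 0#) +p (v ∷ʳ 0#)) (map-∷ʳ (r *_) 0# w) ⟩
    ((0# ∷ w) ∷ʳ 0#) +p ((map (r *_) w ∷ʳ r * 0#) ∷ʳ 0#)
      ≈⟨ V.∙-congˡ (∷ʳ⁺ (∷ʳ⁺ ≋-refl (zeroʳ r)) refl) ⟩
    ((0# ∷ w) ∷ʳ 0#) +p ((map (r *_) w ∷ʳ 0#) ∷ʳ 0#)
      ≈⟨ +p-∷ʳ0# _ _ ⟩
    mulXr r w ∷ʳ 0# ∎
    where open ≋-Reasoning

  mulXr-scale : ∀ {n} r s (u : Vec Carrier n) → mulXr r (map (s *_) u) ≋ map (s *_) (mulXr r u)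
  mulXr-scale r s u = begin
    (0# ∷ map (s *_) u) +p (map (r *_) (map (s *_) u) ∷ʳ 0#)
      ≈⟨ V.∙-cong (sym (zeroʳ s) ∷ ≋-refl) (∷ʳ⁺ (scale-comm r s u) (sym (zeroʳ s))) ⟩
    map (s *_) (0# ∷ u) +p (map (s *_) (map (r *_) u) ∷ʳ s * 0#)
      ≡⟨ ≡.cong (map (s *_) (0# ∷ u) +p_) (map-∷ʳ (s *_) 0# (map (r *_) u)) ⟨
    map (s *_) (0# ∷ u) +p map (s *_) (map (r *_) u ∷ʳ 0#)
      ≈⟨ scale-+p s _ _ ⟨
    map (s *_) (mulXr r u) ∎
    where open ≋-Reasoning

  subst-cong : ∀ {n r s} {u v : Vec Carrier n} → r ≈ s → u ≋ v → subst r u ≋ subst s v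
  subst-cong r≈s []         = []
  subst-cong r≈s (a≈b ∷ ps) = V.∙-cong (const-cong a≈b) (mulXr-cong r≈s (subst-cong r≈s ps))

  subst-+p : ∀ {n} r (u v : Vec Carrier n) → subst r (u +p v) ≋ subst r u +p subst r v
  subst-+p r []      []      = []
  subst-+p r (a ∷ u) (b ∷ v) = begin
    const (a + b) +p mulXr r (subst r (u +p v))
      ≈⟨ V.∙-cong (const-+ a b) (mulXr-cong refl (subst-+p r u v)) ⟩
    (const a +p const b) +p mulXr r (subst r u +p subst r v)
      ≈⟨ V.∙-congˡ (mulXr-+p r _ _) ⟩
    (const a +p const b) +p (mulXr r (subst r u) +p mulXr r (subst r v))
      ≈⟨ V.interchange _ _ _ _ ⟩
    subst r (a ∷ u) +p subst r (b ∷ v) ∎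
    where open ≋-Reasoning

  module SubstHomo (r : Carrier) {n : ℕ} =
    GroupHomomorphism (V.group {n}) V.group (subst r) (subst-cong refl) (subst-+p r)

  subst-const : ∀ {n} r a → subst r (const {n} a) ≋ const a
  subst-const {n} r a = begin
    const a +p mulXr r (subst r 0p) ≈⟨ V.∙-congˡ (mulXr-cong refl (SubstHomo.homo-ε r)) ⟩
    const a +p mulXr r 0p           ≈⟨ V.∙-congˡ (mulXr-0p n r) ⟩
    const a +p 0p                   ≈⟨ V.identityʳ _ ⟩
    const a                         ∎
    where open ≋-Reasoning

  subst-∷ʳ : ∀ {n} r (u : Vec Carrier n) → subst r (u ∷ʳ 0#) ≋ subst r u ∷ʳ 0#
  subst-∷ʳ r []      = trans (+-identityˡ _) (+-identityˡ 0#) ∷ []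
  subst-∷ʳ r (a ∷ u) = begin
    const a +p mulXr r (subst r (u ∷ʳ 0#))
      ≈⟨ V.∙-cong (refl ∷ ≋-sym (0p∷ʳ0# _)) (mulXr-cong refl (subst-∷ʳ r u)) ⟩
    (const a ∷ʳ 0#) +p mulXr r (subst r u ∷ʳ 0#)
      ≈⟨ V.∙-congˡ (mulXr-∷ʳ r (subst r u)) ⟩
    (const a ∷ʳ 0#) +p (mulXr r (subst r u) ∷ʳ 0#)
      ≈⟨ +p-∷ʳ0# _ _ ⟩
    subst r (a ∷ u) ∷ʳ 0# ∎
    where open ≋-Reasoning

  subst-scale : ∀ {n} r s (u : Vec Carrier n) → subst r (map (s *_) u) ≋ map (s *_) (subst r u)
  subst-scale r s []      = []
  subst-scale r s (a ∷ u) = begin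
    const (s * a) +p mulXr r (subst r (map (s *_) u))
      ≈⟨ V.∙-cong (refl ∷ ≋-sym (scale-0p _ s)) (mulXr-cong refl (subst-scale r s u)) ⟩
    map (s *_) (const a) +p mulXr r (map (s *_) (subst r u))
      ≈⟨ V.∙-congˡ (mulXr-scale r s (subst r u)) ⟩
    map (s *_) (const a) +p map (s *_) (mulXr r (subst r u))
      ≈⟨ scale-+p s _ _ ⟨
    map (s *_) (subst r (a ∷ u)) ∎
    where open ≋-Reasoning

  subst-mulXr : ∀ {n} r s (u : Vec Carrier n) → subst r (mulXr s u) ≋ mulXr (r + s) (subst r u)
  subst-mulXr r s u = begin
    subst r ((0# ∷ u) +p (map (s *_) u ∷ʳ 0#))
      ≈⟨ subst-+p r (0# ∷ u) (map (s *_) u ∷ʳ 0#) ⟩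
    (0p +p mulXr r U) +p subst r (map (s *_) u ∷ʳ 0#)
      ≈⟨ V.∙-cong (V.identityˡ _)
                  (≋-trans (subst-∷ʳ r (map (s *_) u)) (∷ʳ⁺ (subst-scale r s u) refl)) ⟩
    ((0# ∷ U) +p (map (r *_) U ∷ʳ 0#)) +p (map (s *_) U ∷ʳ 0#)
      ≈⟨ V.assoc _ _ _ ⟩
    (0# ∷ U) +p ((map (r *_) U ∷ʳ 0#) +p (map (s *_) U ∷ʳ 0#))
      ≈⟨ V.∙-congˡ
           (≋-trans (+p-∷ʳ0# (map (r *_) U) (map (s *_) U)) (∷ʳ⁺ (scale-+ r s U) refl)) ⟩
    mulXr (r + s) U ∎
    where
    U = subst r u
    open ≋-Reasoning

  subst-subst : ∀ {n} r s (u : Vec Carrier n) → subst r (subst s u) ≋ subst (r + s) u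
  subst-subst r s []      = []
  subst-subst r s (a ∷ u) = begin
    subst r (const a +p mulXr s (subst s u))
      ≈⟨ subst-+p r (const a) (mulXr s (subst s u)) ⟩
    subst r (const a) +p subst r (mulXr s (subst s u))
      ≈⟨ V.∙-cong (subst-const r a) (subst-mulXr r s (subst s u)) ⟩
    const a +p mulXr (r + s) (subst r (subst s u))
      ≈⟨ V.∙-congˡ (mulXr-cong refl (subst-subst r s u)) ⟩
    subst (r + s) (a ∷ u) ∎
    where open ≋-Reasoning

  head-+p : ∀ {n} (u v : Vec Carrier (suc n)) → head (u +p v) ≡ head u + head v
  head-+p (a ∷ u) (b ∷ v) = ≡.refl

  head-mulXr : ∀ {n} r (u : Vec Carrier (suc n)) → head (mulXr r u) ≡ 0# + r * head u
  head-mulXr r (a ∷ u) = ≡.refl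

  -- Evaluation is read off from translation, so the properties of eval follow from those of subst.
  head-subst : ∀ {n} r (u : Vec Carrier (suc n)) → head (subst r u) ≈ eval r u
  head-subst r (a ∷ [])    = +-congˡ (trans (+-identityˡ 0#) (sym (zeroʳ r)))
  head-subst r (a ∷ b ∷ u) = begin
    head (const a +p mulXr r (subst r (b ∷ u)))   ≡⟨ head-+p (const a) (mulXr r (subst r (b ∷ u))) ⟩
    a + head (mulXr r (subst r (b ∷ u)))          ≡⟨ ≡.cong (a +_) (head-mulXr r (subst r (b ∷ u))) ⟩
    a + (0# + r * head (subst r (b ∷ u)))         ≈⟨ +-congˡ (+-identityˡ _) ⟩
    a + r * head (subst r (b ∷ u))                ≈⟨ +-congˡ (*-congˡ (head-subst r (b ∷ u))) ⟩
    eval r (a ∷ b ∷ u)                            ∎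
    where open SetoidReasoning (CommutativeRing.setoid R)

  eval-cong : ∀ {n r s} {u v : Vec Carrier n} → r ≈ s → u ≋ v → eval r u ≈ eval s v
  eval-cong r≈s []         = refl
  eval-cong r≈s (a≈b ∷ ps) = +-cong a≈b (*-cong r≈s (eval-cong r≈s ps))

  eval-+p : ∀ {n} r (u v : Vec Carrier (suc n)) → eval r (u +p v) ≈ eval r u + eval r v
  eval-+p r u v = begin
    eval r (u +p v)                       ≈⟨ head-subst r (u +p v) ⟨
    head (subst r (u +p v))               ≈⟨ head⁺ (subst-+p r u v) ⟩
    head (subst r u +p subst r v)         ≡⟨ head-+p (subst r u) (subst r v) ⟩
    head (subst r u) + head (subst r v)   ≈⟨ +-cong (head-subst r u) (head-subst r v) ⟩
    eval r u + eval r v                   ∎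
    where open SetoidReasoning (CommutativeRing.setoid R)

  eval-subst : ∀ {n} r s (u : Vec Carrier (suc n)) → eval r (subst s u) ≈ eval (r + s) u
  eval-subst r s u = begin
    eval r (subst s u)              ≈⟨ head-subst r (subst s u) ⟨
    head (subst r (subst s u))      ≈⟨ head⁺ (subst-subst r s u) ⟩
    head (subst (r + s) u)          ≈⟨ head-subst (r + s) u ⟩
    eval (r + s) u                  ∎
    where open SetoidReasoning (CommutativeRing.setoid R)

  eval-const : ∀ {n} r a → eval r (const {n} a) ≈ a
  eval-const {n} r a = trans (sym (head-subst r (const {n} a))) (head⁺ (subst-const {n} r a))

  A-cong : ∀ {n r s} {u v : Vec Carrier (suc n)} → r ≈ s → u ≋ v → A r u ≋ A s v
  A-cong r≈s u≋v = -p-cong (subst-cong r≈s u≋v) (const-cong (eval-cong r≈s u≋v))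

  A-+p : ∀ {n} r (u v : Vec Carrier (suc n)) → A r (u +p v) ≋ A r u +p A r v
  A-+p r u v = begin
    subst r (u +p v) -p const (eval r (u +p v))
      ≈⟨ -p-cong (subst-+p r u v) (≋-trans (const-cong (eval-+p r u v)) (const-+ _ _)) ⟩
    (subst r u +p subst r v) -p (const (eval r u) +p const (eval r v))
      ≈⟨ -p≋- _ _ ⟩
    (subst r u +p subst r v) V.- (const (eval r u) +p const (eval r v))
      ≈⟨ -‿interchange (+p-abelianGroup _) _ _ _ _ ⟩
    (subst r u V.- const (eval r u)) +p (subst r v V.- const (eval r v))
      ≈⟨ V.∙-cong (-p≋- _ _) (-p≋- _ _) ⟨
    A r u +p A r v ∎
    where open ≋-Reasoning

  module AHomo (r : Carrier) {n : ℕ} =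
    GroupHomomorphism (V.group {suc n}) V.group (A r) (A-cong refl) (A-+p r)

  A-const : ∀ {n} r a → A r (const {n} a) ≋ 0p {suc n}
  A-const {n} r a = begin
    A r a′               ≈⟨ -p-cong (subst-const r a) (const-cong (eval-const {n} r a)) ⟩
    a′ -p a′             ≈⟨ -p≋- a′ a′ ⟩
    a′ V.- a′            ≈⟨ V.inverseʳ a′ ⟩
    0p                   ∎
    where
    a′ = const {n} a
    open ≋-Reasoning

  A-subst : ∀ {n} r s (u : Vec Carrier (suc n)) → A r (subst s u) ≋ A (r + s) u
  A-subst r s u = -p-cong (subst-subst r s u) (const-cong (eval-subst r s u))

  A-A : ∀ {n} r s (u : Vec Carrier (suc n)) → A r (A s u) ≋ A (r + s) u
  A-A r s u = begin
    A r (subst s u -p const (eval s u))          ≈⟨ A-cong refl (-p≋- (subst s u) (const (eval s u))) ⟩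
    A r (subst s u V.- const (eval s u))         ≈⟨ AHomo.homo-// r (subst s u) (const (eval s u)) ⟩
    A r (subst s u) V.- A r (const (eval s u))
      ≈⟨ V.∙-cong (A-subst r s u) (V.⁻¹-cong (A-const r (eval s u))) ⟩
    A (r + s) u V.- 0p                           ≈⟨ V.∙-congˡ V.ε⁻¹≈ε ⟩
    A (r + s) u +p 0p                            ≈⟨ V.identityʳ _ ⟩
    A (r + s) u                                  ∎
    where open ≋-Reasoning

  A-natCast : ∀ {n} j r (u : Vec Carrier (suc n)) → A (natCast (suc j) * r) u ≋ fold u (A r) (suc j)
  A-natCast zero    r u = A-cong (trans (*-congʳ (+-identityʳ 1#)) (*-identityˡ r)) (≋-refl {x = u})
  A-natCast (suc j) r u = begin
    A ((1# + natCast (suc j)) * r) u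
      ≈⟨ A-cong (trans (distribʳ r 1# _) (+-congʳ (*-identityˡ r))) (≋-refl {x = u}) ⟩
    A (r + natCast (suc j) * r) u          ≈⟨ A-A r _ u ⟨
    A r (A (natCast (suc j) * r) u)        ≈⟨ A-cong refl (A-natCast j r u) ⟩
    A r (fold u (A r) (suc j))             ∎
    where open ≋-Reasoning

  A-I-cong : ∀ {n} r {u v : Vec Carrier (suc n)} → u ≋ v → A-I r u ≋ A-I r v
  A-I-cong r u≋v = -p-cong (A-cong refl u≋v) u≋v

  iter≈fold : ∀ {n} {g h : Vec Carrier n → Vec Carrier n} → (∀ {u v} → u ≋ v → g u ≋ g v) →
              (∀ u → g u ≋ h u) → ∀ k u → iter k g u ≋ fold u h k
  iter≈fold g-cong g≋h zero    u = ≋-refl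
  iter≈fold g-cong g≋h (suc k) u = ≋-trans (g-cong (iter≈fold g-cong g≋h k u)) (g≋h _)

  IsZeroPoly⇒≋0p : ∀ {n} (u : Vec Carrier n) → IsZeroPoly u → u ≋ 0p {n}
  IsZeroPoly⇒≋0p []      u≈0 = []
  IsZeroPoly⇒≋0p (a ∷ u) u≈0 = u≈0 zero ∷ IsZeroPoly⇒≋0p u (u≈0 ∘ suc)

  ≋0p⇒IsZeroPoly : ∀ {n} {u : Vec Carrier n} → u ≋ 0p {n} → IsZeroPoly u
  ≋0p⇒IsZeroPoly u≋0 j = trans (Pointwise.lookup u≋0 j) (reflexive (lookup-replicate j 0#))

  module Kernel (r : Carrier) {n : ℕ} =
    DifferenceOperator (+p-abelianGroup (suc n)) (A r) (A-cong refl) (A-+p r)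

  ker-A-I⊆ker-A-I : ∀ {n} j k {r s} (u : Vec Carrier (suc n)) → s ≈ natCast (suc j) * r →
                    IsZeroPoly (iter k (A-I r) u) → IsZeroPoly (iter k (A-I s) u)
  ker-A-I⊆ker-A-I j k {r} {s} u s≈jr Aʳu≈0 =
    ≋0p⇒IsZeroPoly (≋-trans (iter≈fold (A-I-cong s) A-I-s≋Δ[j+1] k u) (Ker⊆Ker-Δ[ suc j ] k ker-Δ))
    where
    open Kernel r
    A-I-s≋Δ[j+1] : ∀ v → A-I s v ≋ Δ[ suc j ] v
    A-I-s≋Δ[j+1] v =
      ≋-trans (-p≋- (A s v) v) (V.∙-congʳ (≋-trans (A-cong s≈jr (≋-refl {x = v})) (A-natCast j r v)))
    ker-Δ : Ker k u
    ker-Δ =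
      ≋-trans (≋-sym (iter≈fold (A-I-cong r) (λ v → -p≋- (A r v) v) k u)) (IsZeroPoly⇒≋0p _ Aʳu≈0)

module NatCast {c ℓ} (R : CommutativeRing c ℓ) where
  open CommutativeRing R hiding (zero)
  open Poly R using (natCast)
  open import Algebra.Properties.Semiring.Mult semiring using (×-homo-+; ×1-homo-*) renaming (_×_ to _×ᴿ_)
  open import Algebra.Properties.Ring ring using (-1*x≈-x; -‿involutive; +-inverseʳ-unique)
  open SetoidReasoning (CommutativeRing.setoid R)

  natCast≡×1# : ∀ n → natCast n ≡ n ×ᴿ 1#
  natCast≡×1# zero    = ≡.refl
  natCast≡×1# (suc n) = ≡.cong (1# +_) (natCast≡×1# n)

  natCast-+ : ∀ a b → natCast (a ℕ.+ b) ≈ natCast a + natCast b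
  natCast-+ a b
    rewrite natCast≡×1# (a ℕ.+ b) | natCast≡×1# a | natCast≡×1# b = ×-homo-+ 1# a b

  natCast-* : ∀ a b → natCast (a ℕ.* b) ≈ natCast a * natCast b
  natCast-* a b
    rewrite natCast≡×1# (a ℕ.* b) | natCast≡×1# a | natCast≡×1# b = ×1-homo-* a b

  module _ {p : ℕ} (p≈0 : natCast p ≈ 0#) where

    natCast-*p : ∀ a → natCast (a ℕ.* p) ≈ 0#
    natCast-*p a = trans (natCast-* a p) (trans (*-congˡ p≈0) (zeroʳ _))

    natCast-1+*p : ∀ a → natCast (1 ℕ.+ a ℕ.* p) ≈ 1#
    natCast-1+*p a = trans (+-congˡ (natCast-*p a)) (+-identityʳ 1#)

    unit-from-Bézout : ∀ {m} → Bézout.Identity 1 p m → ∃ λ a → natCast a * natCast m ≈ 1#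
    unit-from-Bézout {m} (Bézout.-+ x y 1+xp≡ym) = y , (begin
      natCast y * natCast m     ≈⟨ natCast-* y m ⟨
      natCast (y ℕ.* m)         ≡⟨ ≡.cong natCast 1+xp≡ym ⟨
      natCast (1 ℕ.+ x ℕ.* p)   ≈⟨ natCast-1+*p x ⟩
      1#                        ∎)
    -- Here y m ≡ -1 (mod p), so y m y is an inverse of m.
    unit-from-Bézout {m} (Bézout.+- x y 1+ym≡xp) = y ℕ.* m ℕ.* y , (begin
      natCast (y ℕ.* m ℕ.* y) * natCast m      ≈⟨ natCast-* (y ℕ.* m ℕ.* y) m ⟨
      natCast (y ℕ.* m ℕ.* y ℕ.* m)            ≡⟨ ≡.cong natCast (ℕ.*-assoc (y ℕ.* m) y m) ⟩
      natCast (y ℕ.* m ℕ.* (y ℕ.* m))          ≈⟨ natCast-* (y ℕ.* m) (y ℕ.* m) ⟩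
      natCast (y ℕ.* m) * natCast (y ℕ.* m)    ≈⟨ *-congʳ ym≈-1 ⟩
      - 1# * natCast (y ℕ.* m)                 ≈⟨ -1*x≈-x _ ⟩
      - natCast (y ℕ.* m)                      ≈⟨ -‿cong ym≈-1 ⟩
      - - 1#                                   ≈⟨ -‿involutive 1# ⟩
      1#                                       ∎)
      where
      ym≈-1 : natCast (y ℕ.* m) ≈ - 1#
      ym≈-1 = +-inverseʳ-unique 1# _ (trans (reflexive (≡.cong natCast 1+ym≡xp)) (natCast-*p x))

  natCast-unit : ∀ {p m} → Prime p → natCast p ≈ 0# → .{{NonZero m}} → m < p →
                 ∃ λ j → natCast (suc j) * natCast m ≈ 1#
  natCast-unit {suc p′} {m} p-prime p≈0 m<p
    with unit-from-Bézout p≈0 (coprime-Bézout (prime⇒coprime p-prime m<p))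
  ... | a , am≈1 = p′ ℕ.+ a , trans (*-congʳ p+a≈a) am≈1
    where
    p+a≈a : natCast (suc p′ ℕ.+ a) ≈ natCast a
    p+a≈a = trans (natCast-+ (suc p′) a) (trans (+-congʳ p≈0) (+-identityˡ _))

-- Only the characteristic p and 1 ≤ m < p matter: the inclusions hold for every k and every
-- polynomial of any length, over any commutative ring.
lemma9 : ∀ {c ℓ} (p n q : ℕ) → Prime p → q ≡ p ^ n
    → (F : CommutativeRing c ℓ) → IsField F
    → Bijection (setoid (Fin q)) (CommutativeRing.setoid F)
    → CommutativeRing._≈_ F (Poly.natCast F p) (CommutativeRing.0# F)
    → (r : CommutativeRing.Carrier F)
    → (m : ℕ) → 1 ≤ m → m < p
    → (k : ℕ) → 1 ≤ k → k ≤ p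
    → (f : Vec (CommutativeRing.Carrier F) (suc (q ∸ 2)))
    → CommutativeRing._≈_ F (Poly.eval F (CommutativeRing.0# F) f) (CommutativeRing.0# F)
    → Poly.IsZeroPoly F (Poly.iter F k (Poly.A-I F r) f)
      ⇔ Poly.IsZeroPoly F (Poly.iter F k (Poly.A-I F (CommutativeRing._*_ F (Poly.natCast F m) r)) f)
lemma9 _ _ _ p-prime _ F _ _ p≈0 r (suc j) _ m<p k _ _ f _
  with NatCast.natCast-unit F p-prime p≈0 m<p
... | j′ , j′m≈1 = mk⇔ (ker-A-I⊆ker-A-I j k f refl) (ker-A-I⊆ker-A-I j′ k f r≈j′mr)
  where
  open CommutativeRing F hiding (zero)
  open Poly F using (natCast)
  open Translation F using (ker-A-I⊆ker-A-I)
  r≈j′mr : r ≈ natCast (suc j′) * (natCast (suc j) * r)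
  r≈j′mr = sym (trans (sym (*-assoc _ _ r)) (trans (*-congʳ j′m≈1) (*-identityˡ r)))
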